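{- Let $n\ge m\ge 1$ be integers and $G=K_m\Box K_n$. Then $s(G)=cs(G)$.
   Context: For a connected graph $G$ and $X\subseteq V(G)$, $G[X]$ denotes the subgraph induced by $X$. A set $S\subseteq V(G)$ is a safe set if for every component $C$ of $G[S]$ and every component $D$ of $G-S$ such that some edge joins $C$ and $D$, we have $|C|\ge |D|$. If moreover $G[S]$ is connected, $S$ is a connected safe set. The safe number $s(G)$ (resp. connected safe number $cs(G)$) is the minimum size of a safe set (resp. connected safe set) of $G$. $K_m \Box K_n$ has vertex set $[m]\times[n]$, with $(i,j)$ and $(i',j')$ adjacent iff either $i=i'$ and $j\neq j'$, or $j=j'$ and $i\ne i'$. -}

module Defs where

open import Data.Bool using (Bool; true; false; not)
open import Data.Nat using (ℕ; _≤_)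
open import Data.Fin using (Fin)
open import Data.List using (List; length; filterᵇ; concatMap; map; allFin)
open import Data.Product using (Σ; _×_; _,_; ∃)
open import Data.Sum using (_⊎_)
open import Relation.Binary.PropositionalEquality using (_≡_; _≢_)

-- A finite (simple) graph: vertex type, adjacency relation, and a list
-- enumerating every vertex exactly once.
record FinGraph : Set₁ where
  field
    V    : Set
    Adj  : V → V → Set
    allV : List V

open FinGraph public

VSet : FinGraph → Set
VSet G = V G → Bool

_∈_ : {G : FinGraph} → V G → VSet G → Set
v ∈ X = X v ≡ true

size : (G : FinGraph) → VSet G → ℕ
size G X = length (filterᵇ X (allV G))

compl : (G : FinGraph) → VSet G → VSet G
compl G X v = not (X v)

data WalkIn (G : FinGraph) (X : VSet G) : V G → V G → Set where
  stop : ∀ {u} → X u ≡ true → WalkIn G X u u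
  step : ∀ {u w v} → X u ≡ true → Adj G u w → WalkIn G X w v → WalkIn G X u v

ConnectedIn : (G : FinGraph) → VSet G → Set
ConnectedIn G X =
  (∃ λ v → X v ≡ true) ×
  (∀ u v → X u ≡ true → X v ≡ true → WalkIn G X u v)

IsComponent : (G : FinGraph) → VSet G → VSet G → Set
IsComponent G X C =
  (∀ v → C v ≡ true → X v ≡ true) ×
  ConnectedIn G C ×
  (∀ u w → C u ≡ true → X w ≡ true → Adj G u w → C w ≡ true)

Joined : (G : FinGraph) → VSet G → VSet G → Set
Joined G C D = ∃ λ u → ∃ λ w → C u ≡ true × D w ≡ true × Adj G u w

IsSafeSet : (G : FinGraph) → VSet G → Set
IsSafeSet G S =
  (∃ λ v → S v ≡ true) ×
  (∀ C D → IsComponent G S C → IsComponent G (compl G S) D →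
     Joined G C D → size G D ≤ size G C)

IsConnectedSafeSet : (G : FinGraph) → VSet G → Set
IsConnectedSafeSet G S = IsSafeSet G S × ConnectedIn G S

IsMinSize : (G : FinGraph) → (VSet G → Set) → ℕ → Set
IsMinSize G P k =
  (Σ (VSet G) λ S → P S × size G S ≡ k) ×
  (∀ S → P S → k ≤ size G S)

IsSafeNumber : (G : FinGraph) → ℕ → Set
IsSafeNumber G = IsMinSize G (IsSafeSet G)

IsConnectedSafeNumber : (G : FinGraph) → ℕ → Set
IsConnectedSafeNumber G = IsMinSize G (IsConnectedSafeSet G)

RookGraph : ℕ → ℕ → FinGraph
RookGraph m n = record
  { V    = Fin m × Fin n
  ; Adj  = λ { (i , j) (i' , j') → (i ≡ i' × j ≢ j') ⊎ (j ≡ j' × i ≢ i') }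
  ; allV = concatMap (λ i → map (i ,_) (allFin n)) (allFin m)
  }

-- Every disconnected safe set S of K_m □ K_n is dominated by a connected safe set, so the minima agree.
-- Take components C₁, C₂ of S that no walk in S joins, and let Cᵢ meet aᵢ rows and bᵢ columns.
-- No vertex in a row of C₁ and a column of C₂ lies in S (it would join them), so that a₁ × b₂
-- rectangle lies in one component D₁ of the complement, adjacent to C₁; likewise an a₂ × b₁
-- rectangle lies in a component D₂ adjacent to C₂. Safety gives a₁b₂ ≤ |D₁| ≤ |C₁| ≤ a₁b₁ and
-- a₂b₁ ≤ |D₂| ≤ |C₂| ≤ a₂b₂, so b₁ = b₂ and each Dᵢ is exactly its rectangle. Hence every row
-- meets C₁ or C₂, and every column meets the columns of C₁ or of C₂. The band T of all vertices in
-- the columns of C₁ is then connected, |T| = m b₁ ≤ a₁b₂ + a₂b₁ ≤ |S|, and |V ∖ T| ≤ m b₂ = |T|,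
-- so T is a connected safe set. The hypothesis m ≤ n only serves to make the graph nonempty.

module Submission where

open import Defs
open import Data.Bool using (Bool; true; false; not; _∧_; _∨_; if_then_else_)
open import Data.Bool.ListAction using (any)
open import Data.Bool.Properties using (∧-conicalˡ; ∧-conicalʳ; ∧-zeroʳ; ∨-zeroʳ) renaming (_≟_ to _≟ᵇ_)
open import Data.Empty using (⊥; ⊥-elim)
open import Data.Fin using (Fin; zero) renaming (_≟_ to _≟ᶠ_)
open import Data.List using (List; []; _∷_; _++_; length; filterᵇ; filter; concatMap; map; allFin)
open import Data.List.Extrema.Nat using (argmin; argmin-all; f[argmin]≤f[xs])
open import Data.List.Membership.Propositional using (lose) renaming (_∈_ to _∈ˡ_)
open import Data.List.Membership.Propositional.Properties using (∈-concatMap⁺; ∈-map⁺; ∈-allFin; ∈-filter⁺)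
open import Data.List.Relation.Unary.All as All using (all?)
open import Data.List.Relation.Unary.All.Properties using (all-filter)
open import Data.List.Relation.Unary.Any using (here; there; any?; satisfied)
open import Data.Nat using (ℕ; suc; _+_; _*_; _≤_; _<_; z≤n; s≤s; _≤?_)
open import Data.Nat.Base using (>-nonZero)
open import Data.Nat.Properties using (m≤n⇒m≤1+n; n≤1+n; +-monoʳ-≤; <⇒≱; ≤-trans; ≤-reflexive; +-suc; <-≤-trans; ≤-pred; ≤-refl; module ≤-Reasoning; ≤-antisym; *-cancelˡ-≤; *-monoˡ-≤; *-distribʳ-+; +-mono-≤; *-monoʳ-≤)
open import Data.Product using (Σ; ∃; _×_; _,_; proj₁; proj₂)
open import Data.Product.Properties using (≡-dec)
open import Data.Sum using (_⊎_; inj₁; inj₂)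
open import Function using (id; _∘_; const; case_of_)
open import Relation.Binary.Definitions using (DecidableEquality)
open import Relation.Binary.PropositionalEquality using (_≡_; _≢_; _≗_; refl; sym; trans; cong; cong₂; subst)
open import Relation.Nullary using (¬_; Dec; yes; no)
open import Relation.Nullary.Decidable using (_×-dec_; _⊎-dec_; _→-dec_; ¬?; ⌊_⌋; map′; decidable-stable)
open import Relation.Unary using (Decidable)

infix 4 _⊆ᵇ_

_⊆ᵇ_ : {A : Set} → (A → Bool) → (A → Bool) → Set
p ⊆ᵇ q = ∀ x → p x ≡ true → q x ≡ true

count : {A : Set} → (A → Bool) → List A → ℕ
count p xs = length (filterᵇ p xs)

module _ {A : Set} where

  count-≗ : {p q : A → Bool} → p ≗ q → ∀ xs → count p xs ≡ count q xs
  count-≗ p≗q [] = refl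
  count-≗ {p} {q} p≗q (x ∷ xs) with p x | q x | p≗q x
  ... | true  | true  | refl = cong suc (count-≗ p≗q xs)
  ... | false | false | refl = count-≗ p≗q xs

  count-mono : {p q : A → Bool} → p ⊆ᵇ q → ∀ xs → count p xs ≤ count q xs
  count-mono p⊆q [] = z≤n
  count-mono {p} {q} p⊆q (x ∷ xs) with p x in px | q x in qx
  ... | true  | true  = s≤s (count-mono p⊆q xs)
  ... | true  | false with () ← trans (sym (p⊆q x px)) qx
  ... | false | true  = m≤n⇒m≤1+n (count-mono p⊆q xs)
  ... | false | false = count-mono p⊆q xs

  count-mono-< : {p q : A → Bool} → p ⊆ᵇ q → ∀ {x xs} → x ∈ˡ xs → q x ≡ true → p x ≡ false →
    count p xs < count q xs
  count-mono-< p⊆q {xs = y ∷ xs} (here refl) qy py rewrite qy | py = s≤s (count-mono p⊆q xs)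
  count-mono-< {p} {q} p⊆q {xs = y ∷ xs} (there x∈xs) qx px with p y in py | q y in qy
  ... | true  | true  = s≤s (count-mono-< p⊆q x∈xs qx px)
  ... | true  | false with () ← trans (sym (p⊆q y py)) qy
  ... | false | true  = m≤n⇒m≤1+n (count-mono-< p⊆q x∈xs qx px)
  ... | false | false = count-mono-< p⊆q x∈xs qx px

  count-mono-tight : {p q : A → Bool} → p ⊆ᵇ q → ∀ {xs} → count q xs ≤ count p xs →
    ∀ {x} → x ∈ˡ xs → q x ≡ true → p x ≡ true
  count-mono-tight {p} p⊆q q≤p {x} x∈xs qx with p x in px
  ... | true  = refl
  ... | false = ⊥-elim (<⇒≱ (count-mono-< p⊆q x∈xs qx px) q≤p)

  count-pos : {p : A → Bool} → ∀ {x xs} → x ∈ˡ xs → p x ≡ true → 1 ≤ count p xs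
  count-pos x∈xs px = ≤-trans (s≤s z≤n) (count-mono-< {p = const false} (λ _ ()) x∈xs px refl)

  count-∨ : (p q : A → Bool) → ∀ xs → count (λ x → p x ∨ q x) xs ≤ count p xs + count q xs
  count-∨ p q [] = z≤n
  count-∨ p q (x ∷ xs) with p x | q x
  ... | true  | true  = s≤s (≤-trans (count-∨ p q xs) (+-monoʳ-≤ (count p xs) (n≤1+n _)))
  ... | true  | false = s≤s (count-∨ p q xs)
  ... | false | true  = ≤-trans (s≤s (count-∨ p q xs)) (≤-reflexive (sym (+-suc _ _)))
  ... | false | false = count-∨ p q xs

  count-disjoint : {p q r : A → Bool} → p ⊆ᵇ r → q ⊆ᵇ r → (∀ x → p x ≡ true → q x ≡ true → ⊥) →
    ∀ xs → count p xs + count q xs ≤ count r xs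
  count-disjoint p⊆r q⊆r disj [] = z≤n
  count-disjoint {p} {q} {r} p⊆r q⊆r disj (x ∷ xs) with p x in px | q x in qx | r x in rx
  ... | true  | true  | _     = ⊥-elim (disj x px qx)
  ... | true  | false | true  = s≤s (count-disjoint p⊆r q⊆r disj xs)
  ... | true  | false | false with () ← trans (sym (p⊆r x px)) rx
  ... | false | true  | true  = ≤-trans (≤-reflexive (+-suc _ _)) (s≤s (count-disjoint p⊆r q⊆r disj xs))
  ... | false | true  | false with () ← trans (sym (q⊆r x qx)) rx
  ... | false | false | true  = m≤n⇒m≤1+n (count-disjoint p⊆r q⊆r disj xs)
  ... | false | false | false = count-disjoint p⊆r q⊆r disj xs

  any-intro : {p : A → Bool} → ∀ {x xs} → x ∈ˡ xs → p x ≡ true → any p xs ≡ true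
  any-intro (here refl) px rewrite px = refl
  any-intro {p} {xs = y ∷ _} (there x∈xs) px with p y
  ... | true  = refl
  ... | false = any-intro x∈xs px

  any-elim : {p : A → Bool} → ∀ xs → any p xs ≡ true → ∃ λ x → p x ≡ true
  any-elim {p} (x ∷ xs) h with p x in px
  ... | true  = x , px
  ... | false = any-elim xs h

  count-++ : (p : A → Bool) → ∀ xs ys → count p (xs ++ ys) ≡ count p xs + count p ys
  count-++ p [] ys = refl
  count-++ p (x ∷ xs) ys with p x
  ... | true  = cong suc (count-++ p xs ys)
  ... | false = count-++ p xs ys

infixr 7 _⊗_

_⊗_ : {A B : Set} → (A → Bool) → (B → Bool) → A × B → Bool
(α ⊗ β) (x , y) = α x ∧ β y

module _ {A B : Set} (α : A → Bool) (β : B → Bool) where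

  count-⊗-row : ∀ {i} ys → α i ≡ true → count (α ⊗ β) (map (i ,_) ys) ≡ count β ys
  count-⊗-row [] αi = refl
  count-⊗-row (y ∷ ys) αi rewrite αi with β y
  ... | true  = cong suc (count-⊗-row ys αi)
  ... | false = count-⊗-row ys αi

  count-⊗-row₀ : ∀ {i} ys → α i ≡ false → count (α ⊗ β) (map (i ,_) ys) ≡ 0
  count-⊗-row₀ [] αi = refl
  count-⊗-row₀ (y ∷ ys) αi rewrite αi = count-⊗-row₀ ys αi

  count-⊗ : ∀ xs ys → count (α ⊗ β) (concatMap (λ i → map (i ,_) ys) xs) ≡ count α xs * count β ys
  count-⊗ [] ys = refl
  count-⊗ (i ∷ xs) ys with α i in αi
  ... | true  = trans (count-++ (α ⊗ β) (map (i ,_) ys) _)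
                      (cong₂ _+_ (count-⊗-row ys αi) (count-⊗ xs ys))
  ... | false = trans (count-++ (α ⊗ β) (map (i ,_) ys) _)
                      (cong₂ _+_ (count-⊗-row₀ ys αi) (count-⊗ xs ys))

record IsFiniteUndirectedGraph (G : FinGraph) : Set where
  field
    _≟_      : DecidableEquality (V G)
    adj?     : ∀ u w → Dec (Adj G u w)
    adj-sym  : ∀ {u w} → Adj G u w → Adj G w u
    complete : ∀ v → v ∈ˡ allV G

module FiniteUndirectedGraph {G : FinGraph} (isGraph : IsFiniteUndirectedGraph G) where
  open IsFiniteUndirectedGraph isGraph

  Walk : VSet G → V G → V G → Set
  Walk = WalkIn G

  walk-start : ∀ {X u v} → Walk X u v → X u ≡ true
  walk-start (stop Xu)     = Xu
  walk-start (step Xu _ _) = Xu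

  walk-end : ∀ {X u v} → Walk X u v → X v ≡ true
  walk-end (stop Xv)    = Xv
  walk-end (step _ _ p) = walk-end p

  walk-++ : ∀ {X u v w} → Walk X u v → Walk X v w → Walk X u w
  walk-++ (stop _)       q = q
  walk-++ (step Xu uw p) q = step Xu uw (walk-++ p q)

  walk-snoc : ∀ {X u v w} → Walk X u v → Adj G v w → X w ≡ true → Walk X u w
  walk-snoc p vw Xw = walk-++ p (step (walk-end p) vw (stop Xw))

  walk-reverse : ∀ {X u v} → Walk X u v → Walk X v u
  walk-reverse (stop Xu)      = stop Xu
  walk-reverse (step Xu uw p) = walk-snoc (walk-reverse p) (adj-sym uw) Xu

  walk-mono : ∀ {X Y u v} → X ⊆ᵇ Y → Walk X u v → Walk Y u v
  walk-mono X⊆Y (stop Xu)      = stop (X⊆Y _ Xu)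
  walk-mono X⊆Y (step Xu uw p) = step (X⊆Y _ Xu) uw (walk-mono X⊆Y p)

  ∃? : {P : V G → Set} → Decidable P → Dec (∃ P)
  ∃? P? = map′ satisfied (λ (v , Pv) → lose (complete v) Pv) (any? P? (allV G))

  ∀? : {P : V G → Set} → Decidable P → Dec (∀ v → P v)
  ∀? P? = map′ (λ Ps v → All.lookup Ps (complete v)) (λ P → All.tabulate (λ {v} _ → P v))
               (all? P? (allV G))

  _-_ : VSet G → V G → VSet G
  (X - u) w = X w ∧ not ⌊ w ≟ u ⌋

  -⊆ : ∀ X u → X - u ⊆ᵇ X
  -⊆ X u w = ∧-conicalˡ (X w) _

  -removed : ∀ X u → (X - u) u ≡ false
  -removed X u with u ≟ u
  ... | yes _ = ∧-zeroʳ (X u)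
  ... | no u≢u = ⊥-elim (u≢u refl)

  -kept : ∀ {X u w} → X w ≡ true → w ≢ u → (X - u) w ≡ true
  -kept {u = u} {w} Xw w≢u with w ≟ u
  ... | yes w≡u = ⊥-elim (w≢u w≡u)
  ... | no _ rewrite Xw = refl

  walk-last-visit : ∀ {X} u {x v} → Walk X x v →
    Walk (X - u) x v ⊎ (u ≡ v ⊎ ∃ λ w → Adj G u w × Walk (X - u) w v)
  walk-last-visit {X} u (stop {x} Xx) with x ≟ u
  ... | yes refl = inj₂ (inj₁ refl)
  ... | no x≢u   = inj₁ (stop (-kept {X} Xx x≢u))
  walk-last-visit {X} u (step {x} {w} Xx xw p) with walk-last-visit u p
  ... | inj₂ visit = inj₂ visit
  ... | inj₁ p′ with x ≟ u
  ...   | yes refl = inj₂ (inj₂ (w , xw , p′))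
  ...   | no x≢u   = inj₁ (step (-kept {X} Xx x≢u) xw p′)

  -- Recursion on |X|: after its last visit to u, a walk from u to v ≠ u stays inside X − u.
  walk?-within : ∀ k X → size G X < k → ∀ u v → Dec (Walk X u v)
  walk?-within (suc k) X |X|<k u v with X u in Xu
  ... | false = no (λ p → case trans (sym (walk-start p)) Xu of λ ())
  ... | true with u ≟ v
  ...   | yes refl = yes (stop Xu)
  ...   | no u≢v   = map′ (λ (w , uw , p) → step Xu uw (walk-mono (-⊆ X u) p)) via-neighbour
                         (∃? λ w → adj? u w ×-dec walk?-within k (X - u) |X-u|<k w v)
    where
    |X-u|<k : size G (X - u) < k
    |X-u|<k = <-≤-trans (count-mono-< (-⊆ X u) (complete u) Xu (-removed X u)) (≤-pred |X|<k)

    via-neighbour : Walk X u v → ∃ λ w → Adj G u w × Walk (X - u) w v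
    via-neighbour p with walk-last-visit u p
    ... | inj₁ p′                  = case trans (sym (walk-start p′)) (-removed X u) of λ ()
    ... | inj₂ (inj₁ u≡v)          = ⊥-elim (u≢v u≡v)
    ... | inj₂ (inj₂ continuation) = continuation

  walk? : ∀ X u v → Dec (Walk X u v)
  walk? X = walk?-within (suc (size G X)) X ≤-refl

  component : VSet G → V G → VSet G
  component X u w = ⌊ walk? X u w ⌋

  component→walk : ∀ {X u w} → component X u w ≡ true → Walk X u w
  component→walk {X} {u} {w} h with walk? X u w
  ... | yes p = p

  walk→component : ∀ {X u w} → Walk X u w → component X u w ≡ true
  walk→component {X} {u} {w} p with walk? X u w
  ... | yes _ = refl
  ... | no ¬p = ⊥-elim (¬p p)

  component⊆ : ∀ X u → component X u ⊆ᵇ X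
  component⊆ X u w h = walk-end (component→walk h)

  walk-within-component : ∀ {X u x y} → Walk X u x → Walk X x y → Walk (component X u) x y
  walk-within-component p (stop _)      = stop (walk→component p)
  walk-within-component p (step _ xw q) =
    step (walk→component p) xw (walk-within-component (walk-snoc p xw (walk-start q)) q)

  component-isComponent : ∀ {X u} → X u ≡ true → IsComponent G X (component X u)
  component-isComponent {X} {u} Xu =
    component⊆ X u ,
    ((u , walk→component (stop Xu)) ,
     λ x y hx hy → walk-within-component (component→walk hx)
                     (walk-++ (walk-reverse (component→walk hx)) (component→walk hy))) ,
    λ x w hx Xw xw → walk→component (walk-snoc (component→walk hx) xw Xw)

  isComponent-walk-closed : ∀ {X C a b} → IsComponent G X C → C a ≡ true → Walk X a b → C b ≡ true
  isComponent-walk-closed isC Ca (stop _)      = Ca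
  isComponent-walk-closed isC Ca (step _ ab p) =
    isComponent-walk-closed isC (proj₂ (proj₂ isC) _ _ Ca (walk-start p) ab) p

  isComponent⊆component : ∀ {X C u} → IsComponent G X C → C u ≡ true → C ⊆ᵇ component X u
  isComponent⊆component (C⊆X , (_ , connected) , _) Cu w Cw =
    walk→component (walk-mono C⊆X (connected _ w Cu Cw))

  component⊆isComponent : ∀ {X C u} → IsComponent G X C → C u ≡ true → component X u ⊆ᵇ C
  component⊆isComponent isC Cu w h = isComponent-walk-closed isC Cu (component→walk h)

  -- Safety checked only on the components at the two ends of each edge leaving S; quantifying over
  -- vertices rather than vertex sets makes it decidable.
  SafeAcrossEdges : VSet G → Set
  SafeAcrossEdges S = (∃ λ v → S v ≡ true) ×
    (∀ u w → S u ≡ true → compl G S w ≡ true → Adj G u w →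
       size G (component (compl G S) w) ≤ size G (component S u))

  safe⇒safeAcrossEdges : ∀ {S} → IsSafeSet G S → SafeAcrossEdges S
  safe⇒safeAcrossEdges {S} (nonempty , safe) = nonempty , λ u w Su S̄w uw →
    safe (component S u) (component (compl G S) w) (component-isComponent Su) (component-isComponent S̄w)
         (u , w , walk→component (stop Su) , walk→component (stop S̄w) , uw)

  safeAcrossEdges⇒safe : ∀ {S} → SafeAcrossEdges S → IsSafeSet G S
  safeAcrossEdges⇒safe {S} (nonempty , safe) = nonempty , λ { C D isC isD (u , w , Cu , Dw , uw) →
    let Su = proj₁ isC u Cu ; S̄w = proj₁ isD w Dw in
    begin
      size G D                         ≤⟨ count-mono (isComponent⊆component isD Dw) (allV G) ⟩
      size G (component (compl G S) w) ≤⟨ safe u w Su S̄w uw ⟩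
      size G (component S u)           ≤⟨ count-mono (component⊆isComponent isC Cu) (allV G) ⟩
      size G C                         ∎ }
    where open ≤-Reasoning

  safe? : ∀ S → Dec (IsSafeSet G S)
  safe? S = map′ safeAcrossEdges⇒safe safe⇒safeAcrossEdges
    (∃? (λ v → S v ≟ᵇ true) ×-dec
     ∀? λ u → ∀? λ w → (S u ≟ᵇ true) →-dec (compl G S w ≟ᵇ true) →-dec adj? u w →-dec
       (size G (component (compl G S) w) ≤? size G (component S u)))

  connected? : ∀ S → Dec (ConnectedIn G S)
  connected? S = ∃? (λ v → S v ≟ᵇ true) ×-dec
    ∀? λ u → ∀? λ v → (S u ≟ᵇ true) →-dec (S v ≟ᵇ true) →-dec walk? S u v

  connectedSafe? : ∀ S → Dec (IsConnectedSafeSet G S)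
  connectedSafe? S = safe? S ×-dec connected? S

  isComponent-resp-≗ : ∀ {X Y C} → X ≗ Y → IsComponent G Y C → IsComponent G X C
  isComponent-resp-≗ X≗Y (C⊆Y , connected , closed) =
    (λ v Cv → trans (X≗Y v) (C⊆Y v Cv)) , connected ,
    λ u w Cu Xw uw → closed u w Cu (trans (sym (X≗Y w)) Xw) uw

  connectedSafe-resp-≗ : ∀ {S S′} → S ≗ S′ → IsConnectedSafeSet G S → IsConnectedSafeSet G S′
  connectedSafe-resp-≗ {S} {S′} S≗S′ (((v , Sv) , safe) , ((v′ , Sv′) , connected)) =
    ((v , trans (sym (S≗S′ v)) Sv) ,
     λ C D isC isD → safe C D (isComponent-resp-≗ S≗S′ isC) (isComponent-resp-≗ (cong not ∘ S≗S′) isD)) ,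
    ((v′ , trans (sym (S≗S′ v′)) Sv′) ,
     λ x y S′x S′y → walk-mono (λ z → trans (sym (S≗S′ z)))
                       (connected x y (trans (S≗S′ x) S′x) (trans (S≗S′ y) S′y)))

  update : VSet G → V G → Bool → VSet G
  update X v b w = if ⌊ w ≟ v ⌋ then b else X w

  subsetsOf : List (V G) → List (VSet G)
  subsetsOf []       = const false ∷ []
  subsetsOf (v ∷ vs) = concatMap (λ X → update X v true ∷ update X v false ∷ []) (subsetsOf vs)

  subsetsOf-complete : ∀ vs (X : VSet G) → ∃ λ Y → Y ∈ˡ subsetsOf vs × (∀ v → v ∈ˡ vs → Y v ≡ X v)
  subsetsOf-complete []       X = const false , here refl , λ _ ()
  subsetsOf-complete (v ∷ vs) X with subsetsOf-complete vs X
  ... | Y , Y∈ , Y≗X = update Y v (X v) , ∈-concatMap⁺ _ (lose Y∈ choice) , agree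
    where
    choice : update Y v (X v) ∈ˡ (update Y v true ∷ update Y v false ∷ [])
    choice with X v
    ... | true  = here refl
    ... | false = there (here refl)

    agree : ∀ w → w ∈ˡ v ∷ vs → update Y v (X v) w ≡ X w
    agree w w∈ with w ≟ v
    agree w w∈           | yes refl = refl
    agree w (here w≡v)   | no w≢v   = ⊥-elim (w≢v w≡v)
    agree w (there w∈vs) | no _     = Y≗X w w∈vs

  minimum-size : {P : VSet G → Set} → Decidable P → (∀ {X Y} → X ≗ Y → P X → P Y) →
    ∃ P → ∃ (IsMinSize G P)
  minimum-size {P} P? resp (X₀ , PX₀) = size G best , (best , Pbest , refl) , best-minimal
    where
    candidates : List (VSet G)
    candidates = filter P? (subsetsOf (allV G))

    best : VSet G
    best = argmin (size G) X₀ candidates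

    Pbest : P best
    Pbest = argmin-all (size G) PX₀ (all-filter P? (subsetsOf (allV G)))

    best-minimal : ∀ S → P S → size G best ≤ size G S
    best-minimal S PS with subsetsOf-complete (allV G) S
    ... | Y , Y∈ , Y≗S = subst (size G best ≤_) (count-≗ Y≗S′ (allV G))
          (All.lookup (f[argmin]≤f[xs] X₀ candidates) (∈-filter⁺ P? Y∈ (resp (sym ∘ Y≗S′) PS)))
      where
      Y≗S′ : Y ≗ S
      Y≗S′ v = Y≗S v (complete v)

  connected⊆isComponent : ∀ {X C} → IsComponent G X C → ConnectedIn G X → X ⊆ᵇ C
  connected⊆isComponent isC (_ , connected) v Xv with proj₁ (proj₁ (proj₂ isC))
  ... | c , Cc = isComponent-walk-closed isC Cc (connected c v (proj₁ isC c Cc) Xv)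

  connectedSafe-of-small-complement : ∀ {T} → ConnectedIn G T → size G (compl G T) ≤ size G T →
    IsConnectedSafeSet G T
  connectedSafe-of-small-complement {T} connected small =
    (proj₁ connected , λ C D isC isD _ →
      begin
        size G D           ≤⟨ count-mono (proj₁ isD) (allV G) ⟩
        size G (compl G T) ≤⟨ small ⟩
        size G T           ≤⟨ count-mono (connected⊆isComponent isC connected) (allV G) ⟩
        size G C           ∎) ,
    connected
    where open ≤-Reasoning

  safeNumber≡connectedSafeNumber :
    ∃ (IsConnectedSafeSet G) →
    (∀ S → IsSafeSet G S → ¬ ConnectedIn G S → ∃ λ T → IsConnectedSafeSet G T × size G T ≤ size G S) →
    Σ ℕ λ k → IsSafeNumber G k × IsConnectedSafeNumber G k
  safeNumber≡connectedSafeNumber some-cs dominated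
    with minimum-size connectedSafe? connectedSafe-resp-≗ some-cs
  ... | k , (T₀ , csT₀ , |T₀|≡k) , cs-minimal =
    k , ((T₀ , proj₁ csT₀ , |T₀|≡k) , safe-minimal) , ((T₀ , csT₀ , |T₀|≡k) , cs-minimal)
    where
    safe-minimal : ∀ S → IsSafeSet G S → k ≤ size G S
    safe-minimal S safe with connected? S
    ... | yes connected = cs-minimal S (safe , connected)
    ... | no disconnected with dominated S safe disconnected
    ...   | T , csT , |T|≤|S| = ≤-trans (cs-minimal T csT) |T|≤|S|

module Rook (m n : ℕ) where

  G : FinGraph
  G = RookGraph m n

  adj-sym : ∀ {u w} → Adj G u w → Adj G w u
  adj-sym (inj₁ (i≡i′ , j≢j′)) = inj₁ (sym i≡i′ , j≢j′ ∘ sym)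
  adj-sym (inj₂ (j≡j′ , i≢i′)) = inj₂ (sym j≡j′ , i≢i′ ∘ sym)

  isFiniteUndirectedGraph : IsFiniteUndirectedGraph G
  isFiniteUndirectedGraph = record
    { _≟_      = ≡-dec _≟ᶠ_ _≟ᶠ_
    ; adj?     = λ (i , j) (i′ , j′) →
                   ((i ≟ᶠ i′) ×-dec ¬? (j ≟ᶠ j′)) ⊎-dec ((j ≟ᶠ j′) ×-dec ¬? (i ≟ᶠ i′))
    ; adj-sym  = adj-sym
    ; complete = λ (i , j) → ∈-concatMap⁺ _ (lose (∈-allFin i) (∈-map⁺ (i ,_) (∈-allFin j)))
    }

  open IsFiniteUndirectedGraph isFiniteUndirectedGraph using (complete)
  open FiniteUndirectedGraph isFiniteUndirectedGraph public

  row-walk : ∀ {X i j j′} → X (i , j) ≡ true → X (i , j′) ≡ true → Walk X (i , j) (i , j′)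
  row-walk {j = j} {j′} Xij Xij′ with j ≟ᶠ j′
  ... | yes refl = stop Xij
  ... | no j≢j′  = step Xij (inj₁ (refl , j≢j′)) (stop Xij′)

  column-walk : ∀ {X i i′ j} → X (i , j) ≡ true → X (i′ , j) ≡ true → Walk X (i , j) (i′ , j)
  column-walk {i = i} {i′} Xij Xi′j with i ≟ᶠ i′
  ... | yes refl = stop Xij
  ... | no i≢i′  = step Xij (inj₂ (refl , i≢i′)) (stop Xi′j)

  rectangle-walk : ∀ {X} {α : Fin m → Bool} {β : Fin n → Bool} → α ⊗ β ⊆ᵇ X →
    ∀ {i₀ j₀ i j} → α i₀ ≡ true → β j₀ ≡ true → α i ≡ true → β j ≡ true → Walk X (i₀ , j₀) (i , j)
  rectangle-walk α⊗β⊆X αi₀ βj₀ αi βj =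
    walk-++ (column-walk (α⊗β⊆X _ (cong₂ _∧_ αi₀ βj₀)) (α⊗β⊆X _ (cong₂ _∧_ αi βj₀)))
            (row-walk (α⊗β⊆X _ (cong₂ _∧_ αi βj₀)) (α⊗β⊆X _ (cong₂ _∧_ αi βj)))

  rectangle-connected : ∀ {α : Fin m → Bool} {β : Fin n → Bool} {i j} → α i ≡ true → β j ≡ true →
    ConnectedIn G (α ⊗ β)
  rectangle-connected {α} {β} αi βj = (_ , cong₂ _∧_ αi βj) , λ (i , j) (i′ , j′) h h′ →
    rectangle-walk (λ _ → id) (∧-conicalˡ (α i) _ h) (∧-conicalʳ (α i) _ h)
                   (∧-conicalˡ (α i′) _ h′) (∧-conicalʳ (α i′) _ h′)

  size-⊗ : ∀ α β → size G (α ⊗ β) ≡ count α (allFin m) * count β (allFin n)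
  size-⊗ α β = count-⊗ α β (allFin m) (allFin n)

  rowsOf : VSet G → Fin m → Bool
  rowsOf X i = any (λ j → X (i , j)) (allFin n)

  columnsOf : VSet G → Fin n → Bool
  columnsOf X j = any (λ i → X (i , j)) (allFin m)

  rowsOf-intro : ∀ {X i j} → X (i , j) ≡ true → rowsOf X i ≡ true
  rowsOf-intro {j = j} = any-intro (∈-allFin j)

  columnsOf-intro : ∀ {X i j} → X (i , j) ≡ true → columnsOf X j ≡ true
  columnsOf-intro {i = i} = any-intro (∈-allFin i)

  ⊆rowsOf⊗columnsOf : ∀ X → X ⊆ᵇ rowsOf X ⊗ columnsOf X
  ⊆rowsOf⊗columnsOf X (i , j) Xij = cong₂ _∧_ (rowsOf-intro {X} Xij) (columnsOf-intro {X} Xij)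

  -- A vertex of S sharing a row with the component of u₁ and a column with that of u₂ would join them.
  separated-rectangle⊆compl : ∀ {S u₁ u₂} → ¬ Walk S u₁ u₂ →
    rowsOf (component S u₁) ⊗ columnsOf (component S u₂) ⊆ᵇ compl G S
  separated-rectangle⊆compl {S} {u₁} {u₂} separated (i , j) h
    with any-elim (allFin n) (∧-conicalˡ _ _ h) | any-elim (allFin m) (∧-conicalʳ _ _ h)
  ... | j₁ , C₁ij₁ | i₂ , C₂i₂j with S (i , j) in Sij
  ... | false = refl
  ... | true  = ⊥-elim (separated (walk-++ u₁⇝ij (walk-reverse u₂⇝ij)))
    where
    u₁⇝ij : Walk S u₁ (i , j)
    u₁⇝ij = walk-++ (component→walk C₁ij₁) (row-walk (component⊆ S u₁ _ C₁ij₁) Sij)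

    u₂⇝ij : Walk S u₂ (i , j)
    u₂⇝ij = walk-++ (component→walk C₂i₂j) (column-walk (component⊆ S u₂ _ C₂i₂j) Sij)

  module SeparatedComponents {S : VSet G} (safe : IsSafeSet G S) {r₁ c₁ r₂ c₂}
      (Su₁ : S (r₁ , c₁) ≡ true) (Su₂ : S (r₂ , c₂) ≡ true)
      (separated : ¬ Walk S (r₁ , c₁) (r₂ , c₂)) where

    C₁ C₂ : VSet G
    C₁ = component S (r₁ , c₁)
    C₂ = component S (r₂ , c₂)

    a₁ a₂ : Fin m → Bool
    a₁ = rowsOf C₁
    a₂ = rowsOf C₂

    b₁ b₂ : Fin n → Bool
    b₁ = columnsOf C₁
    b₂ = columnsOf C₂

    A₁ A₂ B₁ B₂ : ℕ
    A₁ = count a₁ (allFin m)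
    A₂ = count a₂ (allFin m)
    B₁ = count b₁ (allFin n)
    B₂ = count b₂ (allFin n)

    C₁u₁ : C₁ (r₁ , c₁) ≡ true
    C₁u₁ = walk→component (stop Su₁)

    C₂u₂ : C₂ (r₂ , c₂) ≡ true
    C₂u₂ = walk→component (stop Su₂)

    a₁⊗b₂⊆S̄ : a₁ ⊗ b₂ ⊆ᵇ compl G S
    a₁⊗b₂⊆S̄ = separated-rectangle⊆compl separated

    a₂⊗b₁⊆S̄ : a₂ ⊗ b₁ ⊆ᵇ compl G S
    a₂⊗b₁⊆S̄ = separated-rectangle⊆compl (separated ∘ walk-reverse)

    S̄r₁c₂ : compl G S (r₁ , c₂) ≡ true
    S̄r₁c₂ = a₁⊗b₂⊆S̄ _ (cong₂ _∧_ (rowsOf-intro {C₁} C₁u₁) (columnsOf-intro {C₂} C₂u₂))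

    S̄r₂c₁ : compl G S (r₂ , c₁) ≡ true
    S̄r₂c₁ = a₂⊗b₁⊆S̄ _ (cong₂ _∧_ (rowsOf-intro {C₂} C₂u₂) (columnsOf-intro {C₁} C₁u₁))

    D₁ D₂ : VSet G
    D₁ = component (compl G S) (r₁ , c₂)
    D₂ = component (compl G S) (r₂ , c₁)

    a₁⊗b₂⊆D₁ : a₁ ⊗ b₂ ⊆ᵇ D₁
    a₁⊗b₂⊆D₁ (i , j) h = walk→component (rectangle-walk a₁⊗b₂⊆S̄
      (rowsOf-intro {C₁} C₁u₁) (columnsOf-intro {C₂} C₂u₂) (∧-conicalˡ (a₁ i) _ h) (∧-conicalʳ (a₁ i) _ h))

    a₂⊗b₁⊆D₂ : a₂ ⊗ b₁ ⊆ᵇ D₂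
    a₂⊗b₁⊆D₂ (i , j) h = walk→component (rectangle-walk a₂⊗b₁⊆S̄
      (rowsOf-intro {C₂} C₂u₂) (columnsOf-intro {C₁} C₁u₁) (∧-conicalˡ (a₂ i) _ h) (∧-conicalʳ (a₂ i) _ h))

    |D₁|≤|C₁| : size G D₁ ≤ size G C₁
    |D₁|≤|C₁| = proj₂ (safe⇒safeAcrossEdges safe) _ _ Su₁ S̄r₁c₂
      (inj₁ (refl , λ { refl → separated (column-walk Su₁ Su₂) }))

    |D₂|≤|C₂| : size G D₂ ≤ size G C₂
    |D₂|≤|C₂| = proj₂ (safe⇒safeAcrossEdges safe) _ _ Su₂ S̄r₂c₁
      (inj₁ (refl , λ { refl → separated (column-walk Su₁ Su₂) }))

    |C₁|≤A₁*B₁ : size G C₁ ≤ A₁ * B₁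
    |C₁|≤A₁*B₁ = subst (size G C₁ ≤_) (size-⊗ a₁ b₁) (count-mono (⊆rowsOf⊗columnsOf C₁) (allV G))

    |C₂|≤A₂*B₂ : size G C₂ ≤ A₂ * B₂
    |C₂|≤A₂*B₂ = subst (size G C₂ ≤_) (size-⊗ a₂ b₂) (count-mono (⊆rowsOf⊗columnsOf C₂) (allV G))

    A₁*B₂≤|D₁| : A₁ * B₂ ≤ size G D₁
    A₁*B₂≤|D₁| = subst (_≤ size G D₁) (size-⊗ a₁ b₂) (count-mono a₁⊗b₂⊆D₁ (allV G))

    A₂*B₁≤|D₂| : A₂ * B₁ ≤ size G D₂
    A₂*B₁≤|D₂| = subst (_≤ size G D₂) (size-⊗ a₂ b₁) (count-mono a₂⊗b₁⊆D₂ (allV G))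

    B₁≡B₂ : B₁ ≡ B₂
    B₁≡B₂ = ≤-antisym
      (*-cancelˡ-≤ A₂ {{>-nonZero (count-pos (∈-allFin r₂) (rowsOf-intro {C₂} C₂u₂))}}
        (≤-trans A₂*B₁≤|D₂| (≤-trans |D₂|≤|C₂| |C₂|≤A₂*B₂)))
      (*-cancelˡ-≤ A₁ {{>-nonZero (count-pos (∈-allFin r₁) (rowsOf-intro {C₁} C₁u₁))}}
        (≤-trans A₁*B₂≤|D₁| (≤-trans |D₁|≤|C₁| |C₁|≤A₁*B₁)))

    D₁⊆a₁⊗b₂ : D₁ ⊆ᵇ a₁ ⊗ b₂
    D₁⊆a₁⊗b₂ w = count-mono-tight a₁⊗b₂⊆D₁ |D₁|≤|a₁⊗b₂| (complete w)
      where
      |D₁|≤|a₁⊗b₂| : size G D₁ ≤ size G (a₁ ⊗ b₂)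
      |D₁|≤|a₁⊗b₂| = begin
        size G D₁        ≤⟨ |D₁|≤|C₁| ⟩
        size G C₁        ≤⟨ |C₁|≤A₁*B₁ ⟩
        A₁ * B₁          ≡⟨ cong (A₁ *_) B₁≡B₂ ⟩
        A₁ * B₂          ≡⟨ size-⊗ a₁ b₂ ⟨
        size G (a₁ ⊗ b₂) ∎
        where open ≤-Reasoning

    D₂⊆a₂⊗b₁ : D₂ ⊆ᵇ a₂ ⊗ b₁
    D₂⊆a₂⊗b₁ w = count-mono-tight a₂⊗b₁⊆D₂ |D₂|≤|a₂⊗b₁| (complete w)
      where
      |D₂|≤|a₂⊗b₁| : size G D₂ ≤ size G (a₂ ⊗ b₁)
      |D₂|≤|a₂⊗b₁| = begin
        size G D₂        ≤⟨ |D₂|≤|C₂| ⟩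
        size G C₂        ≤⟨ |C₂|≤A₂*B₂ ⟩
        A₂ * B₂          ≡⟨ cong (A₂ *_) B₁≡B₂ ⟨
        A₂ * B₁          ≡⟨ size-⊗ a₂ b₁ ⟨
        size G (a₂ ⊗ b₁) ∎
        where open ≤-Reasoning

    -- Column c₁ runs through C₁ on S and through D₂ off S.
    every-row-meets : ∀ i → a₁ i ∨ a₂ i ≡ true
    every-row-meets i with S (i , c₁) in Sic₁
    ... | true  = cong (_∨ a₂ i) (rowsOf-intro {C₁} (walk→component (column-walk Su₁ Sic₁)))
    ... | false = trans (cong (a₁ i ∨_) (∧-conicalˡ (a₂ i) _ (D₂⊆a₂⊗b₁ _ D₂ic₁))) (∨-zeroʳ (a₁ i))
      where
      D₂ic₁ : D₂ (i , c₁) ≡ true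
      D₂ic₁ = walk→component (column-walk S̄r₂c₁ (cong not Sic₁))

    -- Row r₁ runs through C₁ on S and through D₁ off S.
    every-column-meets : ∀ j → b₁ j ∨ b₂ j ≡ true
    every-column-meets j with S (r₁ , j) in Sr₁j
    ... | true  = cong (_∨ b₂ j) (columnsOf-intro {C₁} (walk→component (row-walk Su₁ Sr₁j)))
    ... | false = trans (cong (b₁ j ∨_) (∧-conicalʳ (a₁ r₁) _ (D₁⊆a₁⊗b₂ _ D₁r₁j))) (∨-zeroʳ (b₁ j))
      where
      D₁r₁j : D₁ (r₁ , j) ≡ true
      D₁r₁j = walk→component (row-walk S̄r₁c₂ (cong not Sr₁j))

    band : VSet G
    band = const true ⊗ b₁

    M : ℕ
    M = count (const true) (allFin m)

    |band|≤|S| : size G band ≤ size G S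
    |band|≤|S| = begin
      size G band            ≡⟨ size-⊗ (const true) b₁ ⟩
      M * B₁                 ≤⟨ *-monoˡ-≤ B₁ M≤A₁+A₂ ⟩
      (A₁ + A₂) * B₁         ≡⟨ *-distribʳ-+ B₁ A₁ A₂ ⟩
      A₁ * B₁ + A₂ * B₁      ≡⟨ cong (λ B → A₁ * B + A₂ * B₁) B₁≡B₂ ⟩
      A₁ * B₂ + A₂ * B₁      ≤⟨ +-mono-≤ (≤-trans A₁*B₂≤|D₁| |D₁|≤|C₁|) (≤-trans A₂*B₁≤|D₂| |D₂|≤|C₂|) ⟩
      size G C₁ + size G C₂  ≤⟨ count-disjoint (component⊆ S _) (component⊆ S _) C₁∩C₂≡∅ (allV G) ⟩
      size G S               ∎
      where
      open ≤-Reasoning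

      M≤A₁+A₂ : M ≤ A₁ + A₂
      M≤A₁+A₂ = ≤-trans (count-mono (λ i _ → every-row-meets i) (allFin m)) (count-∨ a₁ a₂ (allFin m))

      C₁∩C₂≡∅ : ∀ w → C₁ w ≡ true → C₂ w ≡ true → ⊥
      C₁∩C₂≡∅ w C₁w C₂w = separated (walk-++ (component→walk C₁w) (walk-reverse (component→walk C₂w)))

    |compl-band|≤|band| : size G (compl G band) ≤ size G band
    |compl-band|≤|band| = begin
      size G (compl G band)            ≡⟨ size-⊗ (const true) (not ∘ b₁) ⟩
      M * count (not ∘ b₁) (allFin n)  ≤⟨ *-monoʳ-≤ M (count-mono b₂-off-b₁ (allFin n)) ⟩
      M * B₂                           ≡⟨ cong (M *_) B₁≡B₂ ⟨
      M * B₁                           ≡⟨ size-⊗ (const true) b₁ ⟨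
      size G band                      ∎
      where
      open ≤-Reasoning

      b₂-off-b₁ : not ∘ b₁ ⊆ᵇ b₂
      b₂-off-b₁ j ¬b₁j with b₁ j | every-column-meets j
      b₂-off-b₁ j () | true  | _
      b₂-off-b₁ j _  | false | b₂j = b₂j

    dominated : ∃ λ T → IsConnectedSafeSet G T × size G T ≤ size G S
    dominated = band ,
      connectedSafe-of-small-complement (rectangle-connected {i = r₁} refl (columnsOf-intro {C₁} C₁u₁))
        |compl-band|≤|band| ,
      |band|≤|S|

  disconnected-safe-dominated : ∀ S → IsSafeSet G S → ¬ ConnectedIn G S →
    ∃ λ T → IsConnectedSafeSet G T × size G T ≤ size G S
  disconnected-safe-dominated S safe disconnected
    with ∃? (λ u → ∃? λ v → (S u ≟ᵇ true) ×-dec (S v ≟ᵇ true) ×-dec ¬? (walk? S u v))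
  ... | yes (_ , _ , Su₁ , Su₂ , separated) = SeparatedComponents.dominated safe Su₁ Su₂ separated
  ... | no never-separated = ⊥-elim (disconnected (proj₁ safe , linked))
    where
    linked : ∀ u v → S u ≡ true → S v ≡ true → Walk S u v
    linked u v Su Sv = decidable-stable (walk? S u v) (λ ¬p → never-separated (u , v , Su , Sv , ¬p))

  whole-connectedSafe : Fin m → Fin n → IsConnectedSafeSet G (const true)
  whole-connectedSafe i j = connectedSafe-of-small-complement
    (rectangle-connected {α = const true} {β = const true} {i} {j} refl refl) (count-mono (λ _ ()) (allV G))

theorem2p10 : (m n : ℕ) → 1 ≤ m → m ≤ n →
    Σ ℕ (λ k → IsSafeNumber (RookGraph m n) k × IsConnectedSafeNumber (RookGraph m n) k)
theorem2p10 (suc m) (suc n) _ (s≤s _) =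
  safeNumber≡connectedSafeNumber (const true , whole-connectedSafe zero zero) disconnected-safe-dominated
  where open Rook (suc m) (suc n)
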